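{- Let $\mathcal{G}$ be a hereditary class of graphs that has only finitely many forbidden induced subgraphs. Then the edge-apex class $\mathcal{G}^{e}$ of $\mathcal{G}$ is hereditary and has only finitely many forbidden induced subgraphs.
   Context: All graphs are finite, simple and undirected. A class of graphs is hereditary if it is closed under taking induced subgraphs (and isomorphism). For a hereditary class $\mathcal{G}$, a forbidden induced subgraph for $\mathcal{G}$ is a graph $H$ not in $\mathcal{G}$ such that every proper induced subgraph of $H$ is in $\mathcal{G}$. The edge-apex class $\mathcal{G}^{e}$ of $\mathcal{G}$ is the class of graphs $G$ such that either $G\in\mathcal{G}$ or $G$ has an edge $e$ with $G-e\in\mathcal{G}$, where $G-e$ denotes deletion of the edge $e$ (keeping all vertices). -}

module Defs where

open import Level using (Level; _⊔_) renaming (suc to lsuc; zero to lzero)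
open import Data.Nat using (ℕ; _<_)
open import Data.Fin using (Fin; _≟_)
open import Data.Bool using (Bool; true; false; _∧_; _∨_; not)
open import Data.Bool.Properties using (∧-comm; ∨-comm)
open import Data.Product using (Σ; _×_; ∃-syntax)
open import Data.Sum using (_⊎_)
open import Data.List using (List)
open import Data.List.Relation.Unary.Any using (Any)
open import Relation.Nullary using (¬_)
open import Relation.Nullary.Decidable using (⌊_⌋)
open import Relation.Binary.PropositionalEquality using (_≡_; refl; cong; cong₂; trans)
open import Function.Definitions using (Injective)

record Graph : Set where
  field
    n      : ℕ
    adj    : Fin n → Fin n → Bool
    adjSym : ∀ i j → adj i j ≡ adj j i
    irrefl : ∀ i → adj i i ≡ false
open Graph public

record _≼_ (H G : Graph) : Set where
  field
    emb      : Fin (n H) → Fin (n G)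
    emb-inj  : Injective _≡_ _≡_ emb
    emb-adj  : ∀ i j → adj H i j ≡ adj G (emb i) (emb j)
open _≼_ public

record _≅_ (H G : Graph) : Set where
  field
    to      : Fin (n H) → Fin (n G)
    from    : Fin (n G) → Fin (n H)
    to-from : ∀ x → to (from x) ≡ x
    from-to : ∀ x → from (to x) ≡ x
    to-adj  : ∀ i j → adj H i j ≡ adj G (to i) (to j)
open _≅_ public

Class : (ℓ : Level) → Set (lsuc ℓ)
Class ℓ = Graph → Set ℓ

Hereditary : ∀ {ℓ} → Class ℓ → Set ℓ
Hereditary 𝒢 = ∀ H G → H ≼ G → 𝒢 G → 𝒢 H

Forbidden : ∀ {ℓ} → Class ℓ → Graph → Set ℓ
Forbidden 𝒢 H = ¬ 𝒢 H × (∀ H' → H' ≼ H → n H' < n H → 𝒢 H')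

FinitelyManyForbidden : ∀ {ℓ} → Class ℓ → Set ℓ
FinitelyManyForbidden 𝒢 =
  Σ (List Graph) λ Fs → ∀ H → Forbidden 𝒢 H → Any (λ F → H ≅ F) Fs

private
  hit : ∀ {m} → Fin m → Fin m → Fin m → Fin m → Bool
  hit u v i j = (⌊ i ≟ u ⌋ ∧ ⌊ j ≟ v ⌋) ∨ (⌊ i ≟ v ⌋ ∧ ⌊ j ≟ u ⌋)

  hit-sym : ∀ {m} (u v i j : Fin m) → hit u v i j ≡ hit u v j i
  hit-sym u v i j =
    trans (cong₂ _∨_ (∧-comm ⌊ i ≟ u ⌋ ⌊ j ≟ v ⌋) (∧-comm ⌊ i ≟ v ⌋ ⌊ j ≟ u ⌋))
          (∨-comm (⌊ j ≟ v ⌋ ∧ ⌊ i ≟ u ⌋) (⌊ j ≟ u ⌋ ∧ ⌊ i ≟ v ⌋))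

deleteEdge : (G : Graph) → Fin (n G) → Fin (n G) → Graph
deleteEdge G u v = record
  { n      = n G
  ; adj    = λ i j → adj G i j ∧ not (hit u v i j)
  ; adjSym = λ i j → cong₂ _∧_ (adjSym G i j) (cong not (hit-sym u v i j))
  ; irrefl = λ i → cong (_∧ not (hit u v i i)) (irrefl G i)
  }

EdgeApex : ∀ {ℓ} → Class ℓ → Class ℓ
EdgeApex 𝒢 G = 𝒢 G ⊎ (Σ (Fin (n G)) λ u → Σ (Fin (n G)) λ v →
                          (adj G u v ≡ true) × 𝒢 (deleteEdge G u v))

{-# OPTIONS --safe #-}
-- Suppose every forbidden graph of 𝒢 has at most s vertices; then every graph
-- outside 𝒢 contains an induced subgraph outside 𝒢 with at most s vertices (an
-- obstruction). Let H be forbidden for 𝒢ᵉ. Choose an obstruction A in H and, for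
-- every pair u, v of vertices of A, an obstruction W_uv in H − uv. If H had more
-- than s + s³ vertices, some vertex x would lie outside A and all the W_uv. Then
-- H − x ∈ 𝒢ᵉ, but H − x contains A, and (H − x) − e contains A unless e = uv lies
-- inside A, in which case it contains W_uv. So the forbidden graphs of 𝒢ᵉ have at
-- most s + s³ vertices, and there are finitely many such graphs up to isomorphism.
-- As 𝒢 need not be decidable, obstructions exist only under double negation;
-- that suffices because the bound on the order of H is decidable.
module Submission where

open import Level using (Level)
open import Data.Bool using (Bool; true; false; T; _∧_; _∨_; not)
open import Data.Bool.Properties
  using (∧-comm; ∧-idem; ∧-identityʳ; ∧-zeroʳ; ∨-identityʳ; T-≡; T-∧; T-∨)
open import Data.Fin using (Fin; zero; suc; _≟_; punchIn; punchOut)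
open import Data.Fin.Properties
  using (punchIn-injective; punchIn-punchOut; injective⇒≤; any?; all?; ¬∀⟶∃¬; ∀-cons; sequence)
open import Data.List
  using (List; []; _∷_; [_]; _++_; map; concat; tabulate; lookup; length; applyUpTo; cartesianProductWith)
open import Data.List.Properties using (length-++; length-tabulate)
open import Data.List.Membership.Propositional using (_∈_; _∉_)
open import Data.List.Relation.Unary.Any as Any using (Any; here; there)
open import Data.List.Relation.Unary.Any.Properties
  using (lookup-index; tabulate⁺; concat⁺; ++⁺ˡ; ++⁺ʳ; map⁺; applyUpTo⁺; cartesianProductWith⁺)
open import Data.Nat using (ℕ; zero; suc; pred; _+_; _*_; _≤_; _<_; _≤?_; z≤n; s≤s)
open import Data.Nat.Induction using (<-wellFounded)
open import Data.Nat.ListAction using (sum)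
open import Data.Nat.Properties
  using (≤-refl; ≤-trans; ≤-reflexive; ≤-<-trans; <⇒≱; ≰⇒>; m≤m+n; m≤n+m; n<1+n; +-mono-≤; *-mono-≤)
open import Data.Nat.Properties using (module ≤-Reasoning)
open import Data.Product using (∃; ∃₂; _×_; _,_; proj₁; proj₂)
import Data.Product as Product
open import Data.Sum using (_⊎_; inj₁; inj₂)
import Data.Sum as Sum
import Data.Vec.Functional as Vector
open import Effect.Monad using (RawMonad)
open import Function using (_∘_; id; Equivalence)
open import Function.Definitions using (Injective)
open import Induction.WellFounded using (Acc; acc)
open import Relation.Binary.PropositionalEquality
  using (_≡_; _≢_; refl; sym; trans; cong; cong₂; ≡-≟-identity; ≢-≟-identity)
open import Relation.Nullary using (¬_; Dec; yes; no; contradiction)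
open import Relation.Nullary.Decidable using (⌊_⌋; toWitness; decidable-stable; ¬¬-excluded-middle)
open import Relation.Nullary.Negation using (¬¬-Monad; ¬∃⟶∀¬)
open import Defs

private
  variable
    ℓ : Level
    m k : ℕ
    F G H : Graph

⌊⌋-cong : ∀ {a b} {A : Set a} {B : Set b} → (A → B) → (B → A) →
          (a? : Dec A) (b? : Dec B) → ⌊ a? ⌋ ≡ ⌊ b? ⌋
⌊⌋-cong f g (yes _) (yes _) = refl
⌊⌋-cong f g (no _)  (no _)  = refl
⌊⌋-cong f g (yes a) (no ¬b) = contradiction (f a) ¬b
⌊⌋-cong f g (no ¬a) (yes b) = contradiction (g b) ¬a

≢⇒⌊≟⌋≡false : {x y : Fin k} → x ≢ y → ⌊ x ≟ y ⌋ ≡ false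
≢⇒⌊≟⌋≡false x≢y = cong ⌊_⌋ (≢-≟-identity _≟_ x≢y)

¬¬-Π : ∀ {p} {P : Fin k → Set p} → (∀ i → ¬ ¬ P i) → ¬ ¬ (∀ i → P i)
¬¬-Π = sequence (RawMonad.rawApplicative ¬¬-Monad)

outsideImage : m < k → (f : Fin m → Fin k) → ∃ λ x → ∀ i → x ≢ f i
outsideImage {k = k} m<k f with all? (λ x → any? (λ i → x ≟ f i))
... | no ¬surjective =
  Product.map₂ ¬∃⟶∀¬ (¬∀⟶∃¬ k _ (λ x → any? (λ i → x ≟ f i)) ¬surjective)
... | yes surjective = contradiction (injective⇒≤ section-injective) (<⇒≱ m<k)
  where
  section-injective : Injective _≡_ _≡_ (proj₁ ∘ surjective)
  section-injective {x} {y} eq =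
    trans (proj₂ (surjective x)) (trans (cong f eq) (sym (proj₂ (surjective y))))

outsideList : (xs : List (Fin k)) → length xs < k → ∃ λ x → x ∉ xs
outsideList xs lt = Product.map₂ (λ x≢ x∈xs → x≢ _ (lookup-index x∈xs)) (outsideImage lt (lookup xs))

length-concat-tabulate≤ : ∀ {a} {A : Set a} {c} (xss : Fin k → List A) →
                          (∀ i → length (xss i) ≤ c) → length (concat (tabulate xss)) ≤ k * c
length-concat-tabulate≤ {zero}  xss bounded = z≤n
length-concat-tabulate≤ {suc k} {c = c} xss bounded = begin
  length (xss zero ++ concat (tabulate (xss ∘ suc)))
    ≡⟨ length-++ (xss zero) ⟩
  length (xss zero) + length (concat (tabulate (xss ∘ suc)))
    ≤⟨ +-mono-≤ (bounded zero) (length-concat-tabulate≤ (xss ∘ suc) (bounded ∘ suc)) ⟩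
  c + k * c
    ∎
  where open ≤-Reasoning

-- Induced subgraphs

≼-refl : G ≼ G
≼-refl = record { emb = id ; emb-inj = id ; emb-adj = λ _ _ → refl }

≼-trans : F ≼ G → G ≼ H → F ≼ H
≼-trans p q = record
  { emb     = emb q ∘ emb p
  ; emb-inj = emb-inj p ∘ emb-inj q
  ; emb-adj = λ i j → trans (emb-adj p i j) (emb-adj q _ _)
  }

≅⇒≼ : H ≅ G → H ≼ G
≅⇒≼ p = record
  { emb     = to p
  ; emb-inj = λ {i} {j} eq → trans (sym (from-to p i)) (trans (cong (from p) eq) (from-to p j))
  ; emb-adj = to-adj p
  }

≼⇒≤ : H ≼ G → n H ≤ n G
≼⇒≤ p = injective⇒≤ (emb-inj p)

induced : (G : Graph) → (Fin k → Fin (n G)) → Graph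
induced {k} G φ = record
  { n      = k
  ; adj    = λ i j → adj G (φ i) (φ j)
  ; adjSym = λ i j → adjSym G (φ i) (φ j)
  ; irrefl = irrefl G ∘ φ
  }

induced-≼ : {φ : Fin k → Fin (n G)} → Injective _≡_ _≡_ φ → induced G φ ≼ G
induced-≼ {φ = φ} φ-inj = record { emb = φ ; emb-inj = φ-inj ; emb-adj = λ _ _ → refl }

Avoids : H ≼ G → Fin (n G) → Set
Avoids p x = ∀ i → x ≢ emb p i

-- `punchIn` and `punchOut` at index `pred m`, so that `G ∖ x` is defined although
-- `n G` need not be a successor.
punchIn′ : Fin m → Fin (pred m) → Fin m
punchIn′ {suc m} = punchIn

punchOut′ : {x y : Fin m} → x ≢ y → Fin (pred m)
punchOut′ {suc m} = punchOut

punchIn′-injective : (x : Fin m) → Injective _≡_ _≡_ (punchIn′ x)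
punchIn′-injective {suc m} x = punchIn-injective x _ _

punchIn′-punchOut′ : {x y : Fin m} (x≢y : x ≢ y) → punchIn′ x (punchOut′ x≢y) ≡ y
punchIn′-punchOut′ {suc m} = punchIn-punchOut

infixl 30 _∖_
_∖_ : (G : Graph) → Fin (n G) → Graph
G ∖ x = induced G (punchIn′ x)

∖-≼ : (x : Fin (n G)) → G ∖ x ≼ G
∖-≼ x = induced-≼ (punchIn′-injective x)

∖-< : (x : Fin (n G)) → n (G ∖ x) < n G
∖-< {G} x with n G
... | suc m = n<1+n m

≼-∖ : (p : H ≼ G) {x : Fin (n G)} → Avoids p x → H ≼ G ∖ x
≼-∖ {G = G} p {x} avoids = record
  { emb     = λ i → punchOut′ (avoids i)
  ; emb-inj = λ {i} {j} eq → emb-inj p (trans (sym (back i)) (trans (cong (punchIn′ x) eq) (back j)))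
  ; emb-adj = λ i j → trans (emb-adj p i j) (sym (cong₂ (adj G) (back i) (back j)))
  }
  where
  back : ∀ i → punchIn′ x (punchOut′ (avoids i)) ≡ emb p i
  back i = punchIn′-punchOut′ (avoids i)

≼-∖-< : (p : H ≼ G) → n H < n G → ∃ λ x → H ≼ G ∖ x
≼-∖-< p H<G = Product.map₂ (≼-∖ p) (outsideImage H<G (emb p))

-- Edge deletion

-- The test of the private `hit` of Defs: `adj (deleteEdge G u v) i j`
-- reduces to `adj G i j ∧ not (hit u v i j)`.
hit : Fin m → Fin m → Fin m → Fin m → Bool
hit u v i j = (⌊ i ≟ u ⌋ ∧ ⌊ j ≟ v ⌋) ∨ (⌊ i ≟ v ⌋ ∧ ⌊ j ≟ u ⌋)

hit-injective : ∀ {φ : Fin k → Fin m} → Injective _≡_ _≡_ φ →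
                ∀ u v a b → hit u v a b ≡ hit (φ u) (φ v) (φ a) (φ b)
hit-injective {φ = φ} φ-inj u v a b =
  cong₂ _∨_ (cong₂ _∧_ (same a u) (same b v)) (cong₂ _∧_ (same a v) (same b u))
  where
  same : ∀ c d → ⌊ c ≟ d ⌋ ≡ ⌊ φ c ≟ φ d ⌋
  same c d = ⌊⌋-cong (cong φ) φ-inj (c ≟ d) (φ c ≟ φ d)

hit-outside : (p : H ≼ G) {U V : Fin (n G)} → Avoids p U ⊎ Avoids p V →
              ∀ a b → hit U V (emb p a) (emb p b) ≡ false
hit-outside p {U} {V} (inj₁ U∉) a b
  rewrite ≢⇒⌊≟⌋≡false (U∉ a ∘ sym) | ≢⇒⌊≟⌋≡false (U∉ b ∘ sym)
  = ∧-zeroʳ _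
hit-outside p {U} {V} (inj₂ V∉) a b
  rewrite ≢⇒⌊≟⌋≡false (V∉ a ∘ sym) | ≢⇒⌊≟⌋≡false (V∉ b ∘ sym)
  = trans (∨-identityʳ _) (∧-zeroʳ _)

hit-endpoints : {u v i j : Fin m} → T (hit u v i j) → (i ≡ u × j ≡ v) ⊎ (i ≡ v × j ≡ u)
hit-endpoints h = Sum.map both both (Equivalence.to T-∨ h)
  where
  both : ∀ {a b c d : Fin _} → T (⌊ a ≟ b ⌋ ∧ ⌊ c ≟ d ⌋) → a ≡ b × c ≡ d
  both {a} {b} {c} {d} t = Product.map (toWitness {a? = a ≟ b}) (toWitness {a? = c ≟ d})
                                       (Equivalence.to (T-∧ {⌊ a ≟ b ⌋}) t)

deleteEdge-≼ : (p : H ≼ G) {u v : Fin (n H)} → deleteEdge H u v ≼ deleteEdge G (emb p u) (emb p v)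
deleteEdge-≼ p {u} {v} = record
  { emb     = emb p
  ; emb-inj = emb-inj p
  ; emb-adj = λ a b → cong₂ (λ c h → c ∧ not h) (emb-adj p a b) (hit-injective (emb-inj p) u v a b)
  }

≼-deleteEdge : (p : H ≼ G) {U V : Fin (n G)} → Avoids p U ⊎ Avoids p V → H ≼ deleteEdge G U V
≼-deleteEdge {G = G} p avoids = record
  { emb     = emb p
  ; emb-inj = emb-inj p
  ; emb-adj = λ a b → trans (emb-adj p a b) (sym (trans
      (cong (λ h → adj G (emb p a) (emb p b) ∧ not h) (hit-outside p avoids a b))
      (∧-identityʳ _)))
  }

≼-deleteEdge-cases : (p : H ≼ G) (U V : Fin (n G)) →
                     H ≼ deleteEdge G U V ⊎ ∃₂ λ u v → U ≡ emb p u × V ≡ emb p v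
≼-deleteEdge-cases p U V with any? (λ u → U ≟ emb p u) | any? (λ v → V ≟ emb p v)
... | yes (u , U≡) | yes (v , V≡) = inj₂ (u , v , U≡ , V≡)
... | no U∉       | _            = inj₁ (≼-deleteEdge p (inj₁ (¬∃⟶∀¬ U∉)))
... | yes _       | no V∉        = inj₁ (≼-deleteEdge p (inj₂ (¬∃⟶∀¬ V∉)))

induced-deleteEdge : {φ : Fin k → Fin (n G)} → Injective _≡_ _≡_ φ →
                     ∀ {u v U V} → φ u ≡ U → φ v ≡ V →
                     induced (deleteEdge G U V) φ ≼ deleteEdge (induced G φ) u v
induced-deleteEdge {G = G} {φ = φ} φ-inj {u} {v} refl refl = record
  { emb     = id
  ; emb-inj = id
  ; emb-adj = λ a b → cong (λ h → adj G (φ a) (φ b) ∧ not h) (sym (hit-injective φ-inj u v a b))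
  }

deleteEdge-nonEdge : {u v : Fin (n G)} → adj G u v ≡ false → G ≼ deleteEdge G u v
deleteEdge-nonEdge {G} {u} {v} uv = record
  { emb = id ; emb-inj = id ; emb-adj = λ i j → sym (unchanged i j) }
  where
  unchanged : ∀ i j → adj G i j ∧ not (hit u v i j) ≡ adj G i j
  unchanged i j with hit u v i j in h
  ... | false = ∧-identityʳ _
  ... | true with hit-endpoints {u = u} {v} {i} {j} (Equivalence.from T-≡ h)
  ...   | inj₁ (refl , refl) = trans (∧-zeroʳ _) (sym uv)
  ...   | inj₂ (refl , refl) = trans (∧-zeroʳ _) (sym (trans (adjSym G v u) uv))

EdgeApex-hereditary : {𝒢 : Class ℓ} → Hereditary 𝒢 → Hereditary (EdgeApex 𝒢)
EdgeApex-hereditary her H G p (inj₁ G∈𝒢) = inj₁ (her H G p G∈𝒢)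
EdgeApex-hereditary her H G p (inj₂ (U , V , UV , G-UV∈𝒢)) with ≼-deleteEdge-cases p U V
... | inj₁ H≼G-UV = inj₁ (her _ _ H≼G-UV G-UV∈𝒢)
... | inj₂ (u , v , refl , refl) =
  inj₂ (u , v , trans (emb-adj p u v) UV , her _ _ (deleteEdge-≼ p) G-UV∈𝒢)

-- Obstructions

OrderBoundedForbidden : Class ℓ → ℕ → Set ℓ
OrderBoundedForbidden 𝒢 s = ∀ H → Forbidden 𝒢 H → n H ≤ s

record Obstruction (𝒢 : Class ℓ) (s : ℕ) (G : Graph) : Set ℓ where
  constructor obstruction
  field
    {graph}  : Graph
    embedded : graph ≼ G
    order≤   : n graph ≤ s
    excluded : ¬ 𝒢 graph
open Obstruction

module _ {𝒢 : Class ℓ} (her : Hereditary 𝒢) where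

  vertexMinimal⇒Forbidden : ¬ 𝒢 F → (∀ x → 𝒢 (F ∖ x)) → Forbidden 𝒢 F
  vertexMinimal⇒Forbidden F∉𝒢 deletions∈𝒢 = F∉𝒢 , λ H H≼F H<F →
    let x , H≼F∖x = ≼-∖-< H≼F H<F in her _ _ H≼F∖x (deletions∈𝒢 x)

  ¬¬-obstruction : ∀ {s} → OrderBoundedForbidden 𝒢 s → ¬ 𝒢 G → ¬ ¬ Obstruction 𝒢 s G
  ¬¬-obstruction {G = G} {s} bounded G∉𝒢 = search G (<-wellFounded (n G)) ≼-refl G∉𝒢
    where
    search : ∀ F → Acc _<_ (n F) → F ≼ G → ¬ 𝒢 F → ¬ ¬ Obstruction 𝒢 s G
    search F (acc smaller) F≼G F∉𝒢 no-obstruction =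
      ¬¬-excluded-middle {A = ∃ λ x → ¬ 𝒢 (F ∖ x)} λ where
        (yes (x , F∖x∉𝒢)) →
          search (F ∖ x) (smaller (∖-< {F} x)) (≼-trans (∖-≼ x) F≼G) F∖x∉𝒢 no-obstruction
        (no ¬∃) → ¬¬-Π (λ x F∖x∉𝒢 → ¬∃ (x , F∖x∉𝒢)) λ deletions∈𝒢 →
          no-obstruction (obstruction F≼G
            (bounded F (vertexMinimal⇒Forbidden F∉𝒢 deletions∈𝒢)) F∉𝒢)

-- Forbidden subgraphs of the edge-apex class

image : H ≼ G → List (Fin (n G))
image p = tabulate (emb p)

module _ {𝒢 : Class ℓ} {s : ℕ} where

  ∉image⇒Avoids : (p : H ≼ G) {x : Fin (n G)} → x ∉ image p → Avoids p x
  ∉image⇒Avoids p x∉ i x≡ = x∉ (tabulate⁺ i x≡)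

  -- One witness for every pair of vertices of A, adjacent or not: deleting a
  -- non-edge changes nothing (`deleteEdge-nonEdge`).
  EdgeWitnesses : (A : Obstruction 𝒢 s H) → Set ℓ
  EdgeWitnesses {H} A =
    ∀ i j → Obstruction 𝒢 s (deleteEdge H (emb (embedded A) i) (emb (embedded A) j))

  length-image≤ : (O : Obstruction 𝒢 s G) → length (image (embedded O)) ≤ s
  length-image≤ O = ≤-trans (≤-reflexive (length-tabulate _)) (order≤ O)

  avoidingVertex : (A : Obstruction 𝒢 s H) (W : EdgeWitnesses A) → s + s * (s * s) < n H →
                   ∃ λ x → Avoids (embedded A) x × ∀ i j → Avoids (embedded (W i j)) x
  avoidingVertex {H} A W large with outsideList images (≤-<-trans images≤ large)
    where
    witnessImages : Fin (n (graph A)) → List (List (Fin (n H)))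
    witnessImages i = tabulate λ j → image (embedded (W i j))

    images : List (Fin (n H))
    images = image (embedded A) ++ concat (tabulate (concat ∘ witnessImages))

    images≤ : length images ≤ s + s * (s * s)
    images≤ = begin
      length images
        ≡⟨ length-++ (image (embedded A)) ⟩
      length (image (embedded A)) + length (concat (tabulate (concat ∘ witnessImages)))
        ≤⟨ +-mono-≤ (length-image≤ A) (length-concat-tabulate≤ _ λ i →
                                        length-concat-tabulate≤ _ λ j → length-image≤ (W i j)) ⟩
      s + n (graph A) * (n (graph A) * s)
        ≤⟨ +-mono-≤ (≤-refl {s}) (*-mono-≤ (order≤ A) (*-mono-≤ (order≤ A) (≤-refl {s}))) ⟩
      s + s * (s * s)
        ∎
      where open ≤-Reasoning
  ... | x , x∉ =
    x , ∉image⇒Avoids (embedded A) (x∉ ∘ ++⁺ˡ)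
      , λ i j → ∉image⇒Avoids (embedded (W i j))
                  (x∉ ∘ ++⁺ʳ _ ∘ concat⁺ ∘ tabulate⁺ i ∘ concat⁺ ∘ tabulate⁺ j)

module _ {𝒢 : Class ℓ} (her : Hereditary 𝒢) where

  ∉EdgeApex⇒deleteEdge∉ : ¬ EdgeApex 𝒢 H → ∀ u v → ¬ 𝒢 (deleteEdge H u v)
  ∉EdgeApex⇒deleteEdge∉ {H} H∉ u v H-uv∈𝒢 with adj H u v in uv
  ... | true  = H∉ (inj₂ (u , v , uv , H-uv∈𝒢))
  ... | false = H∉ (inj₁ (her _ _ (deleteEdge-nonEdge uv) H-uv∈𝒢))

  ∖-∉EdgeApex : ∀ {s} (A : Obstruction 𝒢 s H) (W : EdgeWitnesses A) {x : Fin (n H)} →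
                Avoids (embedded A) x → (∀ i j → Avoids (embedded (W i j)) x) →
                ¬ EdgeApex 𝒢 (H ∖ x)
  ∖-∉EdgeApex A W A-avoids W-avoids (inj₁ H∖x∈𝒢) =
    excluded A (her _ _ (≼-∖ (embedded A) A-avoids) H∖x∈𝒢)
  ∖-∉EdgeApex {H} A W {x} A-avoids W-avoids (inj₂ (u , v , _ , H∖x-uv∈𝒢))
    with ≼-deleteEdge-cases (≼-∖ (embedded A) A-avoids) u v
  ... | inj₁ A≼H∖x-uv = excluded A (her _ _ A≼H∖x-uv H∖x-uv∈𝒢)
  ... | inj₂ (i , j , refl , refl) = excluded (W i j) (her _ _ W≼H∖x-uv H∖x-uv∈𝒢)
    where
    W≼H∖x-uv : graph (W i j) ≼ deleteEdge (H ∖ x) (punchOut′ (A-avoids i)) (punchOut′ (A-avoids j))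
    W≼H∖x-uv = ≼-trans (≼-∖ (embedded (W i j)) (W-avoids i j))
      (induced-deleteEdge {G = H} (punchIn′-injective x)
        (punchIn′-punchOut′ (A-avoids i)) (punchIn′-punchOut′ (A-avoids j)))

  EdgeApex-orderBoundedForbidden : ∀ {s} → OrderBoundedForbidden 𝒢 s →
                                   OrderBoundedForbidden (EdgeApex 𝒢) (s + s * (s * s))
  EdgeApex-orderBoundedForbidden {s} bounded H (H∉ , proper∈) =
    decidable-stable (n H ≤? s + s * (s * s)) λ H-large →
    ¬¬-obstruction her bounded (H∉ ∘ inj₁) λ A →
    ¬¬-Π (λ i → ¬¬-Π λ j →
      ¬¬-obstruction her bounded (∉EdgeApex⇒deleteEdge∉ H∉ _ _)) λ W →
    let x , A-avoids , W-avoids = avoidingVertex A W (≰⇒> H-large)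
    in ∖-∉EdgeApex A W A-avoids W-avoids (proper∈ (H ∖ x) (∖-≼ x) (∖-< {H} x))

-- Finitely many graphs of bounded order

functions : ∀ {a} {A : Set a} k → List A → List (Fin k → A)
functions zero    xs = [ (λ ()) ]
functions (suc k) xs = cartesianProductWith Vector._∷_ xs (functions k xs)

functions-complete : ∀ {a b r} {A : Set a} {B : Set b} (R : B → A → Set r) {xs : List A}
                     (f : Fin k → B) → (∀ i → Any (R (f i)) xs) →
                     Any (λ g → ∀ i → R (f i) (g i)) (functions k xs)
functions-complete {zero}  R f covered = here λ ()
functions-complete {suc k} R f covered =
  cartesianProductWith⁺ Vector._∷_ ∀-cons
    (covered zero) (functions-complete R (f ∘ suc) (covered ∘ suc))

fromMatrix : (Fin k → Fin k → Bool) → Graph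
fromMatrix {k} M = record
  { n      = k
  ; adj    = λ i j → not ⌊ i ≟ j ⌋ ∧ (M i j ∧ M j i)
  ; adjSym = λ i j →
      cong₂ (λ d e → not d ∧ e) (⌊⌋-cong sym sym (i ≟ j) (j ≟ i)) (∧-comm (M i j) (M j i))
  ; irrefl = λ i → cong (λ d → not d ∧ (M i i ∧ M i i)) (cong ⌊_⌋ (≡-≟-identity _≟_ {i} refl))
  }

fromMatrix-≅ : {M : Fin (n H) → Fin (n H) → Bool} → (∀ i j → adj H i j ≡ M i j) →
               H ≅ fromMatrix M
fromMatrix-≅ {H} {M} H≡M = record
  { to = id ; from = id ; to-from = λ _ → refl ; from-to = λ _ → refl ; to-adj = same }
  where
  same : ∀ i j → adj H i j ≡ not ⌊ i ≟ j ⌋ ∧ (M i j ∧ M j i)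
  same i j with i ≟ j
  ... | yes refl = irrefl H i
  ... | no _     = trans (sym (∧-idem _)) (cong₂ _∧_ (H≡M i j) (trans (adjSym H i j) (H≡M j i)))

bools : List Bool
bools = true ∷ false ∷ []

graphsOfOrder : ℕ → List Graph
graphsOfOrder k = map fromMatrix (functions k (functions k bools))

graphsOfOrder-complete : ∀ H → Any (H ≅_) (graphsOfOrder (n H))
graphsOfOrder-complete H = map⁺ (Any.map fromMatrix-≅ matrix∈)
  where
  bool∈ : ∀ b → b ∈ bools
  bool∈ true  = here refl
  bool∈ false = there (here refl)

  matrix∈ : Any (λ M → ∀ i j → adj H i j ≡ M i j) (functions (n H) (functions (n H) bools))
  matrix∈ = functions-complete (λ r g → ∀ j → r j ≡ g j) (adj H) λ i →
              functions-complete _≡_ (adj H i) (bool∈ ∘ adj H i)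

graphsUpTo : ℕ → List Graph
graphsUpTo N = concat (applyUpTo graphsOfOrder (suc N))

graphsUpTo-complete : ∀ {N} → n H ≤ N → Any (H ≅_) (graphsUpTo N)
graphsUpTo-complete {H} H≤N =
  concat⁺ (applyUpTo⁺ graphsOfOrder (graphsOfOrder-complete H) (s≤s H≤N))

≅-order≤sum : ∀ {Fs} → Any (H ≅_) Fs → n H ≤ sum (map n Fs)
≅-order≤sum {Fs = F ∷ Fs} (here H≅F) = ≤-trans (≼⇒≤ (≅⇒≼ H≅F)) (m≤m+n (n F) _)
≅-order≤sum {Fs = F ∷ Fs} (there H∈Fs) = ≤-trans (≅-order≤sum H∈Fs) (m≤n+m _ (n F))

module _ {𝒢 : Class ℓ} where

  orderBounded⇒finitelyManyForbidden : ∀ {N} → OrderBoundedForbidden 𝒢 N → FinitelyManyForbidden 𝒢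
  orderBounded⇒finitelyManyForbidden {N} bounded =
    graphsUpTo N , λ H H-forbidden → graphsUpTo-complete (bounded H H-forbidden)

  finitelyManyForbidden⇒orderBounded : ∀ Fs → (∀ H → Forbidden 𝒢 H → Any (H ≅_) Fs) →
                                       OrderBoundedForbidden 𝒢 (sum (map n Fs))
  finitelyManyForbidden⇒orderBounded Fs complete H H-forbidden =
    ≅-order≤sum (complete H H-forbidden)

theorem1p2 : ∀ {ℓ : Level} (𝒢 : Class ℓ) → Hereditary 𝒢 → FinitelyManyForbidden 𝒢 →
    Hereditary (EdgeApex 𝒢) × FinitelyManyForbidden (EdgeApex 𝒢)
theorem1p2 𝒢 her (Fs , complete) =
  EdgeApex-hereditary her ,
  orderBounded⇒finitelyManyForbidden
    (EdgeApex-orderBoundedForbidden her (finitelyManyForbidden⇒orderBounded Fs complete))
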